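{- Let $n\geq 3$ and $\vec{x}\in\mathbb{Z}^n$. If $2\leq k(\vec{x})<n$, then $f(\vec{x})\leq\max\{\vec{x}(3),\vec{x}(k(\vec{x})+1)\}$.
   Context: For $\vec{x}\in\mathbb{Z}^n$ write $\vec{x}(i)$ for its $i$-th entry. $k(\vec{x})=n$ if $\vec{x}(1)>\cdots>\vec{x}(n)$, otherwise the least $k$ with $\vec{x}(k)\leq\vec{x}(k+1)$. $l(\vec{x})$ is the least $l$ with $1\leq l<k(\vec{x})$, $\vec{x}(l)>\vec{x}(l+1)+1$ and $\vec{x}(l+1)=\vec{x}(l+2)+1$ if it exists, otherwise $k(\vec{x})-1$. The function $f:\mathbb{Z}^n\to\mathbb{Z}$ (Bailey–Cowles) is given by: $f(\vec{x})=\vec{x}(1)$ if $k(\vec{x})=n$, and $f(\vec{x})=\max\{\vec{x}(l(\vec{x})+2),\vec{x}(k(\vec{x})+1)\}$ if $k(\vec{x})<n$. -}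

module Defs where

open import Data.Nat as ℕ using (ℕ; zero; suc; _∸_; _<?_)
open import Data.Fin using (Fin; fromℕ<)
open import Data.Integer as ℤ using (ℤ; _⊔_; _≤?_; _≟_)
open import Relation.Nullary using (yes; no)

-- A vector x ∈ ℤⁿ is a function Fin n → ℤ.
-- x ⟨ i ⟩ is the 1-based entry x(i); indices outside 1..n return 0
-- (the definitions below only query in-range indices).
_⟨_⟩ : ∀ {n} → (Fin n → ℤ) → ℕ → ℤ
_⟨_⟩ {n} x zero = ℤ.0ℤ
_⟨_⟩ {n} x (suc i) with i <? n
... | yes p = x (fromℕ< p)
... | no _  = ℤ.0ℤ

kFrom : ∀ {n} → (Fin n → ℤ) → ℕ → ℕ → ℕ
kFrom {n} x zero i = n
kFrom {n} x (suc fuel) i with i <? n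
... | no _ = n
... | yes _ with x ⟨ i ⟩ ≤? x ⟨ suc i ⟩
...   | yes _ = i
...   | no _  = kFrom x fuel (suc i)

kfun : ∀ {n} → (Fin n → ℤ) → ℕ
kfun {n} x = kFrom x n 1

lFrom : ∀ {n} → (Fin n → ℤ) → ℕ → ℕ → ℕ
lFrom {n} x zero i = kfun x ∸ 1
lFrom {n} x (suc fuel) i with i <? kfun x
... | no _ = kfun x ∸ 1
... | yes _ with x ⟨ suc i ⟩ ℤ.+ ℤ.1ℤ ℤ.<? x ⟨ i ⟩
...   | no _ = lFrom x fuel (suc i)
...   | yes _ with x ⟨ suc i ⟩ ≟ x ⟨ suc (suc i) ⟩ ℤ.+ ℤ.1ℤ
...     | yes _ = i
...     | no _  = lFrom x fuel (suc i)

lfun : ∀ {n} → (Fin n → ℤ) → ℕ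
lfun {n} x = lFrom x n 1

f : ∀ {n} → (Fin n → ℤ) → ℤ
f {n} x with kfun x ℕ.≟ n
... | yes _ = x ⟨ 1 ⟩
... | no _  = x ⟨ suc (suc (lfun x)) ⟩ ⊔ x ⟨ suc (kfun x) ⟩

module Submission where

open import Defs
open import Data.Nat using (ℕ; suc; zero; _≤_; _<_; _+_; _∸_; _<?_; z≤n; s≤s)
open import Data.Nat.Properties as ℕ
  using (≤-trans; n≤1+n; +-suc; m≤n⇒m<n∨m≡n; ≮⇒≥; <-irrefl; <-≤-trans; m≤m+n)
open import Data.Fin using (Fin)
open import Data.Integer using (ℤ; _⊔_) renaming (_≤_ to _≤ℤ_; _<_ to _<ℤ_)
import Data.Integer as ℤ
open import Data.Integer.Properties using (≰⇒>; <⇒≤; ≤-refl; i≤i⊔j; i≤j⊔i; ⊔-lub)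
  renaming (≤-trans to ≤ℤ-trans)
open import Data.Product using (_×_; _,_)
open import Data.Sum using (inj₁; inj₂)
open import Data.Empty using (⊥-elim)
open import Relation.Nullary using (yes; no)
open import Relation.Binary.PropositionalEquality using (refl; sym; subst)

-- The entries x(1), …, x(k) strictly decrease and x(l+2) lies among x(3), …, x(k+1),
-- since 1 ≤ l < k; so x(l+2) is bounded by x(3) unless l+2 = k+1.

module _ {n : ℕ} (x : Fin n → ℤ) where

  kFrom-descending : ∀ fuel i → n ≤ fuel + i →
                     ∀ j → i ≤ j → j < kFrom x fuel i → x ⟨ suc j ⟩ <ℤ x ⟨ j ⟩
  kFrom-descending zero i n≤i j i≤j j<n = ⊥-elim (<-irrefl refl (<-≤-trans j<n (≤-trans n≤i i≤j)))
  kFrom-descending (suc fuel) i n≤fuel+i j i≤j j<k with i <? n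
  ... | no i≮n = ⊥-elim (<-irrefl refl (<-≤-trans j<k (≤-trans (≮⇒≥ i≮n) i≤j)))
  ... | yes _ with x ⟨ i ⟩ ℤ.≤? x ⟨ suc i ⟩
  ...   | yes _ = ⊥-elim (<-irrefl refl (<-≤-trans j<k i≤j))
  ...   | no xᵢ≰xᵢ₊₁ with m≤n⇒m<n∨m≡n i≤j
  ...     | inj₂ refl = ≰⇒> xᵢ≰xᵢ₊₁
  ...     | inj₁ i<j = kFrom-descending fuel (suc i) (subst (n ≤_) (sym (+-suc fuel i)) n≤fuel+i) j i<j j<k

  kfun-descending : ∀ j → 1 ≤ j → j < kfun x → x ⟨ suc j ⟩ <ℤ x ⟨ j ⟩
  kfun-descending = kFrom-descending n 1 (m≤m+n n 1)

  kfun-antitone : ∀ {i} j → 1 ≤ i → i ≤ j → j ≤ kfun x → x ⟨ j ⟩ ≤ℤ x ⟨ i ⟩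
  kfun-antitone zero 1≤i i≤0 _ = ⊥-elim (<-irrefl refl (≤-trans 1≤i i≤0))
  kfun-antitone (suc j) 1≤i i≤1+j 1+j≤k with m≤n⇒m<n∨m≡n i≤1+j
  ... | inj₂ refl = ≤-refl
  ... | inj₁ (s≤s i≤j) =
    ≤ℤ-trans (<⇒≤ (kfun-descending j (≤-trans 1≤i i≤j) 1+j≤k))
             (kfun-antitone j 1≤i i≤j (≤-trans (n≤1+n j) 1+j≤k))

  lFrom-bounds : 2 ≤ kfun x → ∀ fuel i → 1 ≤ i → 1 ≤ lFrom x fuel i × lFrom x fuel i < kfun x
  lFrom-bounds 2≤k = go
    where
    pred-bounds : ∀ k → 2 ≤ k → 1 ≤ k ∸ 1 × k ∸ 1 < k
    pred-bounds (suc k) (s≤s 1≤k) = 1≤k , ℕ.≤-refl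

    k-1-bounds : 1 ≤ kfun x ∸ 1 × kfun x ∸ 1 < kfun x
    k-1-bounds = pred-bounds (kfun x) 2≤k

    go : ∀ fuel i → 1 ≤ i → 1 ≤ lFrom x fuel i × lFrom x fuel i < kfun x
    go zero i _ = k-1-bounds
    go (suc fuel) i 1≤i with i <? kfun x
    ... | no _ = k-1-bounds
    ... | yes i<k with x ⟨ suc i ⟩ ℤ.+ ℤ.1ℤ ℤ.<? x ⟨ i ⟩
    ...   | no _ = go fuel (suc i) (≤-trans 1≤i (n≤1+n i))
    ...   | yes _ with x ⟨ suc i ⟩ ℤ.≟ x ⟨ suc (suc i) ⟩ ℤ.+ ℤ.1ℤ
    ...     | yes _ = 1≤i , i<k
    ...     | no _ = go fuel (suc i) (≤-trans 1≤i (n≤1+n i))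

  entry-after-lfun-bound : 2 ≤ kfun x → x ⟨ suc (suc (lfun x)) ⟩ ≤ℤ x ⟨ 3 ⟩ ⊔ x ⟨ suc (kfun x) ⟩
  entry-after-lfun-bound 2≤k with lFrom-bounds 2≤k n 1 ℕ.≤-refl
  ... | 1≤l , l<k with m≤n⇒m<n∨m≡n (s≤s l<k)
  ...   | inj₁ (s≤s l+2≤k) =
    ≤ℤ-trans (kfun-antitone (suc (suc (lfun x))) (s≤s z≤n) (s≤s (s≤s 1≤l)) l+2≤k) (i≤i⊔j _ _)
  ...   | inj₂ l+2≡k+1 = subst (λ m → x ⟨ m ⟩ ≤ℤ x ⟨ 3 ⟩ ⊔ x ⟨ suc (kfun x) ⟩) (sym l+2≡k+1) (i≤j⊔i _ _)

lemma3p9 : (n : ℕ) → 3 ≤ n → (x : Fin n → ℤ) → 2 ≤ kfun x → kfun x < n →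
    f x ≤ℤ (x ⟨ 3 ⟩ ⊔ x ⟨ suc (kfun x) ⟩)
lemma3p9 n _ x 2≤k k<n with kfun x ℕ.≟ n
... | yes k≡n = ⊥-elim (<-irrefl k≡n k<n)
... | no _ = ⊔-lub (entry-after-lfun-bound x 2≤k) (i≤j⊔i _ _)
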